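{- Let $n_1\le n_2$ be positive integers with $n_1$ odd. Put $a=\lfloor n_1/2\rfloor$, $m=\lceil n_1/2\rceil=a+1$ and $h=\lceil n_2/2\rceil$. Define the arrangement $A$ of $1,\dots,n_1n_2$ in an $n_1\times n_2$ matrix by placing in cell $(r,c)$ (row $r$, column $c$) the number - $(c-1)a+r$ if $r\le a$, $c\le h$; - $ha+c$ if $r=m$, $c\le h$; - $(c-1)a+h+r$ if $r\le a$, $c>h$; - $(c-1)a+an_2+h+(r-m)$ if $r>m$, $c\le h$; - $(n_2+h)a+c$ if $r=m$, $c>h$; - $(n_2+c-1)a+n_2+(r-m)$ if $r>m$, $c>h$. Then $A$ has spread $\frac{(n_1+1)n_2}{2}-1$, and hence (this being the lower bound for all arrangements when $n_1$ is odd) $A$ is an arrangement of minimum spread.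
   Context: An arrangement of $1,\dots,n_1n_2$ in an $n_1\times n_2$ matrix is a bijection between $\{1,\dots,n_1n_2\}$ and the cells $\{(r,c):1\le r\le n_1,1\le c\le n_2\}$. A line is a row or a column. The spread of an arrangement is the maximum, over all lines, of the difference between the largest and smallest number in the line. -}

module Defs where

open import Data.Nat using (ℕ; zero; suc; _+_; _*_; _∸_; _≤_; _⊔_; _⊓_; _≤ᵇ_; _≡ᵇ_; _/_)
open import Data.Fin using (Fin; toℕ) renaming (zero to fzero; suc to fsuc)
open import Data.Bool using (if_then_else_)
open import Data.Product using (_×_; ∃₂)
open import Relation.Binary.PropositionalEquality using (_≡_)

-- An n₁ × n₂ matrix of natural numbers; rows indexed by Fin n₁, columns by Fin n₂
-- (row r, column c of the paper correspond to toℕ r + 1, toℕ c + 1).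
Matrix : ℕ → ℕ → Set
Matrix n₁ n₂ = Fin n₁ → Fin n₂ → ℕ

IsArrangement : ∀ {n₁ n₂} → Matrix n₁ n₂ → Set
IsArrangement {n₁} {n₂} A =
  (∀ r c → 1 ≤ A r c × A r c ≤ n₁ * n₂)
  × (∀ r c r' c' → A r c ≡ A r' c' → r ≡ r' × c ≡ c')
  × (∀ k → 1 ≤ k → k ≤ n₁ * n₂ → ∃₂ λ r c → A r c ≡ k)

-- largest / smallest entry of a line (only used for nonempty lines)
maxF : ∀ {n} → (Fin n → ℕ) → ℕ
maxF {zero} f = 0
maxF {suc n} f = f fzero ⊔ maxF (λ i → f (fsuc i))

minF : ∀ {n} → (Fin n → ℕ) → ℕ
minF {zero} f = 0
minF {suc zero} f = f fzero
minF {suc (suc n)} f = f fzero ⊓ minF (λ i → f (fsuc i))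

lineDiff : ∀ {n} → (Fin n → ℕ) → ℕ
lineDiff f = maxF f ∸ minF f

spread : ∀ {n₁ n₂} → Matrix n₁ n₂ → ℕ
spread {n₁} {n₂} A =
  maxF (λ r → lineDiff (λ c → A r c)) ⊔ maxF (λ c → lineDiff (λ r → A r c))

-- the entry at (1-based) row r, column c of the paper's arrangement A
entry : ℕ → ℕ → ℕ → ℕ → ℕ
entry n₁ n₂ r c =
  if r ≤ᵇ a then
    (if c ≤ᵇ h then (c ∸ 1) * a + r else (c ∸ 1) * a + h + r)
  else if r ≡ᵇ m then
    (if c ≤ᵇ h then h * a + c else (n₂ + h) * a + c)
  else
    (if c ≤ᵇ h then (c ∸ 1) * a + a * n₂ + h + (r ∸ m)
               else (n₂ + c ∸ 1) * a + n₂ + (r ∸ m))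
  where
  a = n₁ / 2
  m = a + 1           -- ⌈n₁/2⌉ (n₁ odd)
  h = (n₂ + 1) / 2

arrA : (n₁ n₂ : ℕ) → Matrix n₁ n₂
arrA n₁ n₂ r c = entry n₁ n₂ (suc (toℕ r)) (suc (toℕ c))

targetSpread : ℕ → ℕ → ℕ
targetSpread n₁ n₂ = ((n₁ + 1) * n₂) / 2 ∸ 1

-- Write n₁ = 2a + 1, N = n₁n₂ and let D be the spread of an arrangement B.  Let s be a
-- threshold at which the entries 1, …, s meet at most a rows while 1, …, s + 1 meet more
-- than a rows.  In a column containing an entry ≤ s + 1, every entry outside the window
-- s + 1, …, s + 1 + D is ≤ s (the column has spread ≤ D), so it lies in one of the ≤ a rows
-- met by 1, …, s; in any other column such an entry is > s + 1 + D, so by the row spread its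
-- row is not met by 1, …, s + 1, and there are at most a such rows.  Thus the at least
-- N − (D + 1) values outside the window occupy at most n₂·a cells, i.e. D ≥ (a + 1)n₂ − 1.
--
-- Conversely A fills the six blocks top rows × left half, middle row × left half,
-- top × right, bottom × left, middle × right, bottom × right one after another, each
-- column by column.  So A is a bijection, and each row and column stays within a stretch
-- of (a + 1)n₂ consecutive values.

module Submission where

open import Defs
open import Data.Nat
  using (ℕ; zero; suc; pred; _+_; _*_; _∸_; _≤_; _<_; _%_; _/_; _≤ᵇ_; _≡ᵇ_; ⌊_/2⌋; ⌈_/2⌉;
         z≤n; s≤s; z<s; s≤s⁻¹; _≤?_; _<?_)
open import Data.Nat.Properties
open import Data.Nat.DivMod using (m≡m%n+[m/n]*n; m/n≡1+[m∸n]/n; m*n/n≡m)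
open import Data.Nat.Tactic.RingSolver using (solve)
open import Data.Bool using (true; false)
open import Data.Fin using (Fin; zero; suc; toℕ; fromℕ<; punchOut; remQuot; combine; inject≤)
open import Data.Fin.Properties
  using (any?; toℕ-injective; fromℕ<-injective; toℕ-fromℕ<; toℕ<n; punchOut-injective;
         injective⇒≤; combine-injective; combine-remQuot; toℕ-combine; inject≤-injective)
  renaming (suc-injective to fsuc-injective; _≟_ to _≟ᶠ_)
open import Data.List using ([]; _∷_)
open import Data.Product using (_×_; _,_; proj₁; proj₂; ∃; ∃₂; uncurry; map)
open import Data.Product.Properties using (×-≡,≡→≡)
open import Data.Sum using (_⊎_; inj₁; inj₂)
open import Function using (_∘_; Injective)
open import Level using (Level; 0ℓ)
open import Relation.Binary.Definitions using (tri<; tri≈; tri>)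
open import Relation.Binary.PropositionalEquality
  using (_≡_; _≢_; refl; sym; trans; cong; cong₂; subst; subst₂; module ≡-Reasoning)
open import Relation.Nullary using (yes; no; contradiction; ¬_)
open import Relation.Nullary.Decidable using (_⊎-dec_; dec-true; dec-false)
open import Relation.Unary using (Pred; Decidable; _⊆_)
open import Relation.Unary.Properties using (∁?)

private variable
  ℓ : Level
  m n : ℕ

count : {P : Pred (Fin n) ℓ} → Decidable P → ℕ
count {n = zero} P? = 0
count {n = suc n} P? with P? zero
... | yes _ = suc (count (P? ∘ suc))
... | no _ = count (P? ∘ suc)

count-mono : {P Q : Pred (Fin n) ℓ} (P? : Decidable P) (Q? : Decidable Q) →
             P ⊆ Q → count P? ≤ count Q?
count-mono {n = zero} P? Q? P⊆Q = z≤n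
count-mono {n = suc n} P? Q? P⊆Q with P? zero | Q? zero
... | yes _ | yes _ = s≤s (count-mono (P? ∘ suc) (Q? ∘ suc) P⊆Q)
... | yes p | no ¬q = contradiction (P⊆Q p) ¬q
... | no _  | yes _ = m≤n⇒m≤1+n (count-mono (P? ∘ suc) (Q? ∘ suc) P⊆Q)
... | no _  | no _  = count-mono (P? ∘ suc) (Q? ∘ suc) P⊆Q

count-none : {P : Pred (Fin n) ℓ} (P? : Decidable P) → (∀ i → ¬ P i) → count P? ≡ 0
count-none {n = zero} P? none = refl
count-none {n = suc n} P? none with P? zero
... | yes p = contradiction p (none zero)
... | no _ = count-none (P? ∘ suc) (none ∘ suc)

count-all : {P : Pred (Fin n) ℓ} (P? : Decidable P) → (∀ i → P i) → count P? ≡ n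
count-all {n = zero} P? all = refl
count-all {n = suc n} P? all with P? zero
... | yes _ = cong suc (count-all (P? ∘ suc) (all ∘ suc))
... | no ¬p = contradiction (all zero) ¬p

count-complement : {P : Pred (Fin n) ℓ} (P? : Decidable P) → count P? + count (∁? P?) ≡ n
count-complement {n = zero} P? = refl
count-complement {n = suc n} P? with P? zero
... | yes _ = cong suc (count-complement (P? ∘ suc))
... | no _ = trans (+-suc _ _) (cong suc (count-complement (P? ∘ suc)))

rank : {P : Pred (Fin n) ℓ} (P? : Decidable P) {i : Fin n} → P i → Fin (count P?)
rank {n = suc n} P? {zero} p with P? zero
... | yes _ = zero
... | no ¬p = contradiction p ¬p
rank {n = suc n} P? {suc i} p with P? zero
... | yes _ = suc (rank (P? ∘ suc) p)
... | no _ = rank (P? ∘ suc) p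

rank-injective : {P : Pred (Fin n) ℓ} (P? : Decidable P) {i j : Fin n} (p : P i) (q : P j) →
                 rank P? p ≡ rank P? q → i ≡ j
rank-injective {n = suc n} P? {zero} {zero} _ _ _ = refl
rank-injective {n = suc n} P? {zero} {suc j} p q eq with P? zero
... | yes _ = contradiction eq λ ()
... | no ¬p = contradiction p ¬p
rank-injective {n = suc n} P? {suc i} {zero} p q eq with P? zero
... | yes _ = contradiction eq λ ()
... | no ¬q = contradiction q ¬q
rank-injective {n = suc n} P? {suc i} {suc j} p q eq with P? zero
... | yes _ = cong suc (rank-injective (P? ∘ suc) p q (fsuc-injective eq))
... | no _ = cong suc (rank-injective (P? ∘ suc) p q eq)

injective⇒surjective : {f : Fin n → Fin n} → Injective _≡_ _≡_ f → ∀ j → ∃ λ i → f i ≡ j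
injective⇒surjective {n = suc n} {f} f-inj j with any? (λ i → f i ≟ᶠ j)
... | yes hit = hit
... | no miss = contradiction (injective⇒≤ avoid-inj) (<-irrefl refl)
  where
  avoid : Fin (suc n) → Fin n
  avoid i = punchOut {i = j} {j = f i} (λ j≡fi → miss (i , sym j≡fi))
  avoid-inj : Injective _≡_ _≡_ avoid
  avoid-inj eq = f-inj (punchOut-injective {i = j} _ _ eq)

prefixSum : (ℕ → ℕ) → ℕ → ℕ
prefixSum f zero = 0
prefixSum f (suc k) = prefixSum f k + f k

prefixSum-mono : ∀ f {k l} → k ≤ l → prefixSum f k ≤ prefixSum f l
prefixSum-mono f {l = zero} z≤n = ≤-refl
prefixSum-mono f {k} {suc l} k≤1+l with m≤n⇒m<n∨m≡n k≤1+l
... | inj₁ k<1+l = ≤-trans (prefixSum-mono f (s≤s⁻¹ k<1+l)) (m≤m+n _ (f l))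
... | inj₂ refl = ≤-refl

InBlock : (ℕ → ℕ) → ℕ → ℕ → Set
InBlock f k v = prefixSum f k < v × v ≤ prefixSum f (suc k)

inBlock-unique : ∀ f {k l v} → InBlock f k v → InBlock f l v → k ≡ l
inBlock-unique f {k} {l} (lo , hi) (lo′ , hi′) with <-cmp k l
... | tri< k<l _ _ = contradiction (≤-trans hi (prefixSum-mono f k<l)) (<⇒≱ lo′)
... | tri≈ _ k≡l _ = k≡l
... | tri> _ _ l<k = contradiction (≤-trans hi′ (prefixSum-mono f l<k)) (<⇒≱ lo)

crossing : ∀ (f : ℕ → ℕ) {a} n → f 0 ≤ a → a < f n →
           ∃ λ s → f s ≤ a × a < f (suc s)
crossing f zero f0≤a a<f0 = contradiction f0≤a (<⇒≱ a<f0)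
crossing f {a} (suc n) f0≤a a<f[1+n] with a <? f n
... | yes a<fn = crossing f n f0≤a a<fn
... | no a≮fn = n , ≮⇒≥ a≮fn , a<f[1+n]

maxF-upper : ∀ (f : Fin n → ℕ) i → f i ≤ maxF f
maxF-upper f zero = m≤m⊔n _ _
maxF-upper f (suc i) = ≤-trans (maxF-upper (f ∘ suc) i) (m≤n⊔m _ _)

maxF-least : ∀ (f : Fin n → ℕ) {K} → (∀ i → f i ≤ K) → maxF f ≤ K
maxF-least {n = zero} f _ = z≤n
maxF-least {n = suc n} f f≤K = ⊔-lub (f≤K zero) (maxF-least (f ∘ suc) (f≤K ∘ suc))

maxF-least-< : ∀ (f : Fin (suc n) → ℕ) {K} → (∀ i → f i < K) → maxF f < K
maxF-least-< {n = zero} f f<K = ⊔-lub (f<K zero) (≤-trans (s≤s z≤n) (f<K zero))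
maxF-least-< {n = suc n} f f<K = ⊔-lub (f<K zero) (maxF-least-< (f ∘ suc) (f<K ∘ suc))

minF-lower : ∀ (f : Fin n → ℕ) i → minF f ≤ f i
minF-lower {n = suc zero} f zero = ≤-refl
minF-lower {n = suc (suc n)} f zero = m⊓n≤m _ _
minF-lower {n = suc (suc n)} f (suc i) = ≤-trans (m⊓n≤n _ _) (minF-lower (f ∘ suc) i)

minF-greatest : ∀ (f : Fin (suc n) → ℕ) {L} → (∀ i → L ≤ f i) → L ≤ minF f
minF-greatest {n = zero} f L≤f = L≤f zero
minF-greatest {n = suc n} f L≤f = ⊓-glb (L≤f zero) (minF-greatest (f ∘ suc) (L≤f ∘ suc))

lineDiff-bounded : ∀ (f : Fin n → ℕ) {L M} → (∀ i → L ≤ f i) → (∀ i → f i < L + M) →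
                   lineDiff f ≤ M ∸ 1
lineDiff-bounded {n = zero} f _ _ = z≤n
lineDiff-bounded {n = suc n} f {L} {M} L≤f f<L+M = begin
  maxF f ∸ minF f       ≤⟨ ∸-monoʳ-≤ (maxF f) (minF-greatest f L≤f) ⟩
  maxF f ∸ L            ≡⟨ cong (_∸ 1) (+-∸-assoc 1 L≤max) ⟨
  suc (maxF f) ∸ L ∸ 1  ≤⟨ ∸-monoˡ-≤ 1 (m≤n+o⇒m∸n≤o (suc (maxF f)) L (maxF-least-< f f<L+M)) ⟩
  M ∸ 1                 ∎
  where
  open ≤-Reasoning
  L≤max : L ≤ maxF f
  L≤max = ≤-trans (L≤f zero) (maxF-upper f zero)

≤+lineDiff : ∀ (f : Fin n → ℕ) i j → f i ≤ f j + lineDiff f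
≤+lineDiff f i j = begin
  f i                        ≤⟨ maxF-upper f i ⟩
  maxF f                     ≤⟨ m≤n+m∸n (maxF f) (minF f) ⟩
  minF f + (maxF f ∸ minF f) ≤⟨ +-monoˡ-≤ (lineDiff f) (minF-lower f j) ⟩
  f j + lineDiff f           ∎
  where open ≤-Reasoning

module _ (B : Matrix m n) where

  ≤+spread-row : ∀ r c c′ → B r c ≤ B r c′ + spread B
  ≤+spread-row r c c′ = ≤-trans (≤+lineDiff (B r) c c′)
    (+-monoʳ-≤ (B r c′) (≤-trans (maxF-upper (λ r → lineDiff (B r)) r) (m≤m⊔n _ _)))

  ≤+spread-col : ∀ r r′ c → B r c ≤ B r′ c + spread B
  ≤+spread-col r r′ c = ≤-trans (≤+lineDiff (λ r → B r c) r r′)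
    (+-monoʳ-≤ (B r′ c) (≤-trans (maxF-upper (λ c → lineDiff (λ r → B r c)) c) (m≤n⊔m _ _)))

  spread-bounded : ∀ {K} → (∀ r → lineDiff (B r) ≤ K) → (∀ c → lineDiff (λ r → B r c) ≤ K) →
                   spread B ≤ K
  spread-bounded rows≤K cols≤K = ⊔-lub (maxF-least _ rows≤K) (maxF-least _ cols≤K)

  injective⇒isArrangement : (∀ r c → 1 ≤ B r c × B r c ≤ m * n) →
                            (∀ r c r′ c′ → B r c ≡ B r′ c′ → r ≡ r′ × c ≡ c′) →
                            IsArrangement B
  injective⇒isArrangement bounds B-inj = bounds , B-inj , surjective
    where
    pred-< : ∀ {v N} → 1 ≤ v × v ≤ N → pred v < N
    pred-< (s≤s _ , v≤N) = v≤N
    pred-cancel : ∀ {v w} → 1 ≤ v → 1 ≤ w → pred v ≡ pred w → v ≡ w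
    pred-cancel (s≤s _) (s≤s _) = cong suc
    cell : Fin (m * n) → Fin m × Fin n
    cell = remQuot n
    index : Fin (m * n) → Fin (m * n)
    index k = fromℕ< (pred-< (uncurry bounds (cell k)))
    index-injective : Injective _≡_ _≡_ index
    index-injective {k} {k′} eq = begin
      k                          ≡⟨ combine-remQuot {m} n k ⟨
      uncurry combine (cell k)   ≡⟨ cong (uncurry combine) (×-≡,≡→≡ same-cell) ⟩
      uncurry combine (cell k′)  ≡⟨ combine-remQuot {m} n k′ ⟩
      k′                         ∎
      where
      open ≡-Reasoning
      same-cell = uncurry (uncurry B-inj (cell k)) (cell k′)
        (pred-cancel (proj₁ (uncurry bounds (cell k))) (proj₁ (uncurry bounds (cell k′)))
          (fromℕ<-injective _ _ _ _ eq))
    surjective : ∀ v → 1 ≤ v → v ≤ m * n → ∃₂ λ r c → B r c ≡ v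
    surjective v 1≤v v≤N
      with injective⇒surjective index-injective (fromℕ< (pred-< (1≤v , v≤N)))
    ... | k , index-k≡v = proj₁ (cell k) , proj₂ (cell k) ,
      pred-cancel (proj₁ (uncurry bounds (cell k))) 1≤v (fromℕ<-injective _ _ _ _ index-k≡v)

module LowerBound (B : Matrix m n) (B-arr : IsArrangement B)
                  (a : ℕ) (a<m : a < m) (m≤2a+1 : m ≤ suc (a + a)) (0<n : 0 < n) where

  private
    D = spread B
    N = m * n
    c₀ = fromℕ< 0<n
    B-bounds = proj₁ B-arr
    B-surj = proj₂ (proj₂ B-arr)

  Reached : ℕ → Pred (Fin m) 0ℓ
  Reached t r = ∃ λ c → B r c ≤ t

  reached? : ∀ t → Decidable (Reached t)
  reached? t r = any? (λ c → B r c ≤? t)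

  nothing-reached : count (reached? 0) ≡ 0
  nothing-reached = count-none (reached? 0) λ r (c , B≤0) → <⇒≱ (proj₁ (B-bounds r c)) B≤0

  everything-reached : count (reached? N) ≡ m
  everything-reached = count-all (reached? N) λ r → c₀ , proj₂ (B-bounds r c₀)

  threshold : ∃ λ s → count (reached? s) ≤ a × a < count (reached? (suc s))
  threshold = crossing (count ∘ reached?) N
    (subst (_≤ a) (sym nothing-reached) z≤n) (subst (a <_) (sym everything-reached) a<m)

  s = proj₁ threshold

  Outside : Pred ℕ 0ℓ
  Outside v = v ≤ s ⊎ suc (s + D) < v

  outside? : Decidable Outside
  outside? v = v ≤? s ⊎-dec suc (s + D) <? v

  column-bound : ∀ c → count (λ r → outside? (B r c)) ≤ a
  column-bound c with any? (λ r → B r c ≤? suc s)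
  ... | yes (r₁ , B≤1+s) = ≤-trans (count-mono _ (reached? s) low) (proj₁ (proj₂ threshold))
    where
    low : ∀ {r} → Outside (B r c) → Reached s r
    low (inj₁ B≤s) = c , B≤s
    low {r} (inj₂ B>) =
      contradiction (≤-trans (≤+spread-col B r r₁ c) (+-monoˡ-≤ D B≤1+s)) (<⇒≱ B>)
  ... | no none = ≤-trans (count-mono _ (∁? (reached? (suc s))) high) unreached≤a
    where
    high : ∀ {r} → Outside (B r c) → ¬ Reached (suc s) r
    high {r} (inj₁ B≤s) _ = none (r , m≤n⇒m≤1+n B≤s)
    high {r} (inj₂ B>) (c′ , B′≤1+s) =
      <⇒≱ B> (≤-trans (≤+spread-row B r c c′) (+-monoˡ-≤ D B′≤1+s))
    unreached≤a : count (∁? (reached? (suc s))) ≤ a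
    unreached≤a = +-cancelˡ-≤ (suc a) _ a (begin
      suc a + count (∁? (reached? (suc s)))
        ≤⟨ +-monoˡ-≤ _ (proj₂ (proj₂ threshold)) ⟩
      count (reached? (suc s)) + count (∁? (reached? (suc s)))
        ≡⟨ count-complement (reached? (suc s)) ⟩
      m
        ≤⟨ m≤2a+1 ⟩
      suc a + a
        ∎)
      where open ≤-Reasoning

  code : ∀ r c → Outside (B r c) → Fin (n * a)
  code r c o = combine c (inject≤ (rank (λ r → outside? (B r c)) o) (column-bound c))

  code-injective : ∀ {r c r′ c′} (o : Outside (B r c)) (o′ : Outside (B r′ c′)) →
                   code r c o ≡ code r′ c′ o′ → r ≡ r′ × c ≡ c′
  code-injective {c = c} {c′ = c′} o o′ eq with combine-injective c _ c′ _ eq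
  ... | refl , same-rank = rank-injective _ o o′ (inject≤-injective _ _ _ _ same-rank) , refl

  skip : ℕ → ℕ
  skip j with j <? s
  ... | yes _ = j
  ... | no _ = suc (j + D)

  s≤1+j+D : ∀ {j} → ¬ j < s → s ≤ suc (j + D)
  s≤1+j+D j≮s = ≤-trans (≮⇒≥ j≮s) (≤-trans (m≤m+n _ D) (n≤1+n _))

  skip-injective : ∀ {j j′} → skip j ≡ skip j′ → j ≡ j′
  skip-injective {j} {j′} eq with j <? s | j′ <? s
  ... | yes _ | yes _ = eq
  ... | no _ | no _ = +-cancelʳ-≡ D j j′ (suc-injective eq)
  ... | yes j<s | no j′≮s = contradiction (s≤1+j+D j′≮s) (<⇒≱ (subst (_< s) eq j<s))
  ... | no j≮s | yes j′<s = contradiction (s≤1+j+D j≮s) (<⇒≱ (subst (_< s) (sym eq) j′<s))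

  skip-outside : ∀ j → Outside (suc (skip j))
  skip-outside j with j <? s
  ... | yes j<s = inj₁ j<s
  ... | no j≮s = inj₂ (s≤s (s≤s (+-monoˡ-≤ D (≮⇒≥ j≮s))))

  skip-< : ∀ {j} → j < N ∸ suc D → skip j < N
  skip-< {j} j<K with j <? s
  ... | yes _ = ≤-trans j<K (m∸n≤m N (suc D))
  ... | no _ = subst (_≤ N) (cong suc (+-suc j D))
                 (m≤o∸n⇒m+n≤o (suc j) (<⇒≤ (m∸n≢0⇒n<m (m<n⇒n≢0 j<K))) j<K)

  located : (j : Fin (N ∸ suc D)) → ∃₂ λ r c → B r c ≡ suc (skip (toℕ j))
  located j = B-surj (suc (skip (toℕ j))) (s≤s z≤n) (skip-< (toℕ<n j))

  encode : Fin (N ∸ suc D) → Fin (n * a)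
  encode j with located j
  ... | r , c , B≡ = code r c (subst Outside (sym B≡) (skip-outside (toℕ j)))

  encode-injective : Injective _≡_ _≡_ encode
  encode-injective {j} {j′} eq with located j | located j′
  ... | r , c , B≡ | r′ , c′ , B′≡ with code-injective _ _ eq
  ...   | refl , refl = toℕ-injective (skip-injective (suc-injective (trans (sym B≡) B′≡)))

  outside-values≤ : N ∸ suc D ≤ n * a
  outside-values≤ = injective⇒≤ encode-injective

spread-lowerBound : (B : Matrix m n) → IsArrangement B →
                    ∀ a → a < m → m ≤ suc (a + a) → 0 < n → m * n ≤ suc (spread B) + a * n
spread-lowerBound {m} {n} B B-arr a a<m m≤2a+1 0<n = begin
  m * n                                      ≤⟨ m≤n+m∸n (m * n) (suc (spread B)) ⟩
  suc (spread B) + (m * n ∸ suc (spread B))  ≤⟨ +-monoʳ-≤ (suc (spread B)) outside-values≤ ⟩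
  suc (spread B) + n * a                     ≡⟨ cong (suc (spread B) +_) (*-comm n a) ⟩
  suc (spread B) + a * n                     ∎
  where
  open ≤-Reasoning
  open LowerBound B B-arr a a<m m≤2a+1 0<n using (outside-values≤)

-- Rows and columns are counted from 0.  The bands top, mid, bot are the rows 0 … a − 1, the
-- row a and the rows a + 1 … 2a; the sides left, right are the columns 0 … h − 1 and
-- h … h + g − 1.  Each block (band, side) is filled column by column, the blocks one after
-- another as listed by order; x and i are the column and the row inside a block.
module SixBlocks (a h g : ℕ) where

  data Band : Set where
    top mid bot : Band

  data Side : Set where
    left right : Side

  width : Band → ℕ
  width top = a
  width mid = 1
  width bot = a

  bandStart : Band → ℕ
  bandStart top = 0
  bandStart mid = a
  bandStart bot = suc a

  cols : Side → ℕ
  cols left = h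
  cols right = g

  sideStart : Side → ℕ
  sideStart left = 0
  sideStart right = h

  order : Band → Side → ℕ
  order top left = 0
  order mid left = 1
  order top right = 2
  order bot left = 3
  order mid right = 4
  order bot right = 5

  blockAt : ℕ → Band × Side
  blockAt 0 = top , left
  blockAt 1 = mid , left
  blockAt 2 = top , right
  blockAt 3 = bot , left
  blockAt 4 = mid , right
  blockAt _ = bot , right

  blockAt-order : ∀ b s → blockAt (order b s) ≡ (b , s)
  blockAt-order top left = refl
  blockAt-order mid left = refl
  blockAt-order top right = refl
  blockAt-order bot left = refl
  blockAt-order mid right = refl
  blockAt-order bot right = refl

  order-injective : ∀ {b s b′ s′} → order b s ≡ order b′ s′ → (b , s) ≡ (b′ , s′)
  order-injective {b} {s} {b′} {s′} eq =
    trans (sym (blockAt-order b s)) (trans (cong blockAt eq) (blockAt-order b′ s′))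

  order<6 : ∀ b s → order b s < 6
  order<6 top left = s≤s z≤n
  order<6 mid left = s≤s (s≤s z≤n)
  order<6 top right = s≤s (s≤s (s≤s z≤n))
  order<6 bot left = s≤s (s≤s (s≤s (s≤s z≤n)))
  order<6 mid right = s≤s (s≤s (s≤s (s≤s (s≤s z≤n))))
  order<6 bot right = ≤-refl

  order-left≤ : ∀ b s → order b left ≤ order b s
  order-left≤ b left = ≤-refl
  order-left≤ top right = z≤n
  order-left≤ mid right = s≤s z≤n
  order-left≤ bot right = s≤s (s≤s (s≤s z≤n))

  order≤right : ∀ b s → order b s ≤ order b right
  order≤right b right = ≤-refl
  order≤right top left = z≤n
  order≤right mid left = s≤s z≤n
  order≤right bot left = s≤s (s≤s (s≤s z≤n))

  top<mid : ∀ s → suc (order top s) ≤ order mid s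
  top<mid left = ≤-refl
  top<mid right = s≤s (s≤s (s≤s z≤n))

  top≤bot : ∀ s → order top s ≤ order bot s
  top≤bot left = z≤n
  top≤bot right = s≤s (s≤s z≤n)

  size : Band × Side → ℕ
  size (b , s) = cols s * width b

  blockStart : ℕ → ℕ
  blockStart = prefixSum (size ∘ blockAt)

  blockStart6 : blockStart 6 ≡ suc (a + a) * (h + g)
  blockStart6 = begin
    blockStart 6                                   ≡⟨⟩
    h * a + h * 1 + g * a + h * a + g * 1 + g * a  ≡⟨ solve (a ∷ h ∷ g ∷ []) ⟩
    suc (a + a) * (h + g)                          ∎
    where open ≡-Reasoning

  span : ℕ
  span = suc a * (h + g)

  band-span : ∀ b → blockStart (suc (order b right)) ≤ blockStart (order b left) + span
  band-span top = begin
    h * a + h * 1 + g * a      ≤⟨ m≤m+n _ g ⟩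
    h * a + h * 1 + g * a + g  ≡⟨ solve (a ∷ h ∷ g ∷ []) ⟩
    suc a * (h + g)            ∎
    where open ≤-Reasoning
  band-span mid = ≤-reflexive (begin
    h * a + h * 1 + g * a + h * a + g * 1  ≡⟨ solve (a ∷ h ∷ g ∷ []) ⟩
    h * a + suc a * (h + g)                ∎)
    where open ≡-Reasoning
  band-span bot = begin
    h * a + h * 1 + g * a + h * a + g * 1 + g * a      ≤⟨ m≤m+n _ h ⟩
    h * a + h * 1 + g * a + h * a + g * 1 + g * a + h  ≡⟨ solve (a ∷ h ∷ g ∷ []) ⟩
    h * a + h * 1 + g * a + suc a * (h + g)            ∎
    where open ≤-Reasoning

  value : ∀ b s → Fin (cols s) → Fin (width b) → ℕ
  value b s x i = blockStart (order b s) + suc (toℕ (combine x i))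

  value-inBlock : ∀ b s x i → InBlock (size ∘ blockAt) (order b s) (value b s x i)
  value-inBlock b s x i = m<m+n _ z<s , +-monoʳ-≤ (blockStart (order b s))
    (subst (suc (toℕ (combine x i)) ≤_) (cong size (sym (blockAt-order b s)))
      (toℕ<n (combine x i)))

  value-unfold : ∀ b s x i →
                 value b s x i ≡ blockStart (order b s) + suc (width b * toℕ x + toℕ i)
  value-unfold b s x i = cong (λ k → blockStart (order b s) + suc k) (toℕ-combine x i)

  -- The six cases of the paper's formula for A, with n₂ = h + g.

  value-topLeft : ∀ x i → value top left x i ≡ toℕ x * a + suc (toℕ i)
  value-topLeft x i = trans (value-unfold top left x i) (closed (toℕ x) (toℕ i))
    where
    closed : ∀ X I → suc (a * X + I) ≡ X * a + suc I
    closed X I = solve (a ∷ X ∷ I ∷ [])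

  value-midLeft : ∀ x → value mid left x zero ≡ h * a + suc (toℕ x)
  value-midLeft x = trans (value-unfold mid left x zero) (closed (toℕ x))
    where
    closed : ∀ X → h * a + suc (1 * X + 0) ≡ h * a + suc X
    closed X = solve (a ∷ h ∷ X ∷ [])

  value-topRight : ∀ x i → value top right x i ≡ (h + toℕ x) * a + h + suc (toℕ i)
  value-topRight x i = trans (value-unfold top right x i) (closed (toℕ x) (toℕ i))
    where
    closed : ∀ X I → h * a + h * 1 + suc (a * X + I) ≡ (h + X) * a + h + suc I
    closed X I = solve (a ∷ h ∷ X ∷ I ∷ [])

  value-botLeft : ∀ {n} → n ≡ h + g → ∀ x i →
                  value bot left x i ≡ toℕ x * a + a * n + h + suc (toℕ i)
  value-botLeft refl x i = trans (value-unfold bot left x i) (closed (toℕ x) (toℕ i))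
    where
    closed : ∀ X I → h * a + h * 1 + g * a + suc (a * X + I) ≡ X * a + a * (h + g) + h + suc I
    closed X I = solve (a ∷ h ∷ g ∷ X ∷ I ∷ [])

  value-midRight : ∀ {n} → n ≡ h + g → ∀ x →
                   value mid right x zero ≡ (n + h) * a + suc (h + toℕ x)
  value-midRight refl x = trans (value-unfold mid right x zero) (closed (toℕ x))
    where
    closed : ∀ X → h * a + h * 1 + g * a + h * a + suc (1 * X + 0) ≡ (h + g + h) * a + suc (h + X)
    closed X = solve (a ∷ h ∷ g ∷ X ∷ [])

  value-botRight : ∀ {n} → n ≡ h + g → ∀ x i →
                   value bot right x i ≡ (n + (h + toℕ x)) * a + n + suc (toℕ i)
  value-botRight refl x i = trans (value-unfold bot right x i) (closed (toℕ x) (toℕ i))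
    where
    closed : ∀ X I → h * a + h * 1 + g * a + h * a + g * 1 + suc (a * X + I)
                     ≡ (h + g + (h + X)) * a + (h + g) + suc I
    closed X I = solve (a ∷ h ∷ g ∷ X ∷ I ∷ [])

  data RowView (ρ : ℕ) : Set where
    row : ∀ b (i : Fin (width b)) → ρ ≡ bandStart b + toℕ i → RowView ρ

  data ColView (γ : ℕ) : Set where
    col : ∀ s (x : Fin (cols s)) → γ ≡ sideStart s + toℕ x → ColView γ

  private variable
    ρ γ ρ′ γ′ : ℕ

  rowView : ρ < suc (a + a) → RowView ρ
  rowView {ρ} ρ< with <-cmp ρ a
  ... | tri< ρ<a _ _ = row top (fromℕ< ρ<a) (sym (toℕ-fromℕ< ρ<a))
  ... | tri≈ _ ρ≡a _ = row mid zero (trans ρ≡a (sym (+-identityʳ a)))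
  ... | tri> _ _ a<ρ with m≤n⇒∃[o]m+o≡n a<ρ
  ...   | j , refl = row bot (fromℕ< j<a) (cong (suc a +_) (sym (toℕ-fromℕ< j<a)))
    where
    j<a : j < a
    j<a = +-cancelˡ-< (suc a) j a ρ<

  colView : γ < h + g → ColView γ
  colView {γ} γ< with γ <? h
  ... | yes γ<h = col left (fromℕ< γ<h) (sym (toℕ-fromℕ< γ<h))
  ... | no γ≮h with m≤n⇒∃[o]m+o≡n (≮⇒≥ γ≮h)
  ...   | y , refl = col right (fromℕ< y<g) (cong (h +_) (sym (toℕ-fromℕ< y<g)))
    where
    y<g : y < g
    y<g = +-cancelˡ-< h y g γ<

  entryAt : RowView ρ → ColView γ → ℕ
  entryAt (row b i _) (col s x _) = value b s x i

  entryAt-injective : (rv : RowView ρ) (cv : ColView γ) (rv′ : RowView ρ′) (cv′ : ColView γ′) →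
                      entryAt rv cv ≡ entryAt rv′ cv′ → ρ ≡ ρ′ × γ ≡ γ′
  entryAt-injective (row b i ρ≡) (col s x γ≡) (row b′ i′ ρ′≡) (col s′ x′ γ′≡) eq
    with order-injective {b} {s} {b′} {s′} (inBlock-unique _ (value-inBlock b s x i)
           (subst (InBlock _ (order b′ s′)) (sym eq) (value-inBlock b′ s′ x′ i′)))
  ... | refl
    with combine-injective x i x′ i′
           (toℕ-injective (suc-injective (+-cancelˡ-≡ (blockStart (order b s)) _ _ eq)))
  ...   | refl , refl = trans ρ≡ (sym ρ′≡) , trans γ≡ (sym γ′≡)

  entryAt-bounds : (rv : RowView ρ) (cv : ColView γ) →
                   1 ≤ entryAt rv cv × entryAt rv cv ≤ suc (a + a) * (h + g)
  entryAt-bounds (row b i _) (col s x _) = ≤-trans (s≤s z≤n) (m≤n+m _ _) , (begin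
    value b s x i                 ≤⟨ proj₂ (value-inBlock b s x i) ⟩
    blockStart (suc (order b s))  ≤⟨ prefixSum-mono _ (order<6 b s) ⟩
    blockStart 6                  ≡⟨ blockStart6 ⟩
    suc (a + a) * (h + g)         ∎)
    where open ≤-Reasoning

  rowBase : RowView ρ → ℕ
  rowBase (row b i _) = blockStart (order b left) + suc (toℕ i)

  rowBase≤entryAt : (rv : RowView ρ) (cv : ColView γ) → rowBase rv ≤ entryAt rv cv
  rowBase≤entryAt (row b i _) (col s x _) = +-mono-≤ (prefixSum-mono _ (order-left≤ b s))
    (s≤s (subst (toℕ i ≤_) (sym (toℕ-combine x i)) (m≤n+m (toℕ i) _)))

  entryAt<rowBase+span : (rv : RowView ρ) (cv : ColView γ) → entryAt rv cv < rowBase rv + span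
  entryAt<rowBase+span (row b i _) (col s x _) = begin-strict
    value b s x i
      ≤⟨ proj₂ (value-inBlock b s x i) ⟩
    blockStart (suc (order b s))
      ≤⟨ prefixSum-mono _ (s≤s (order≤right b s)) ⟩
    blockStart (suc (order b right))
      ≤⟨ band-span b ⟩
    blockStart (order b left) + span
      <⟨ +-monoˡ-< span (m<m+n (blockStart (order b left)) z<s) ⟩
    blockStart (order b left) + suc (toℕ i) + span
      ∎
    where open ≤-Reasoning

  colBase : ColView γ → ℕ
  colBase (col s x _) = blockStart (order top s) + suc (a * toℕ x)

  colBase≤value : ∀ b s {X I} → X < cols s →
                  blockStart (order top s) + suc (a * X)
                    ≤ blockStart (order b s) + suc (width b * X + I)
  colBase≤value top s _ = +-monoʳ-≤ _ (s≤s (m≤m+n _ _))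
  colBase≤value mid s {X} {I} X<cols = begin
    blockStart (order top s) + suc (a * X)      ≡⟨ +-suc _ _ ⟩
    suc (blockStart (order top s) + a * X)      ≤⟨ s≤s (+-monoʳ-≤ _ aX≤size) ⟩
    suc (blockStart (suc (order top s)))        ≤⟨ s≤s (prefixSum-mono _ (top<mid s)) ⟩
    suc (blockStart (order mid s))              ≤⟨ m<m+n _ z<s ⟩
    blockStart (order mid s) + suc (1 * X + I)  ∎
    where
    open ≤-Reasoning
    aX≤size : a * X ≤ size (blockAt (order top s))
    aX≤size = subst (a * X ≤_) (trans (*-comm a (cols s)) (cong size (sym (blockAt-order top s))))
                (*-monoʳ-≤ a (<⇒≤ X<cols))
  colBase≤value bot s _ = +-mono-≤ (prefixSum-mono _ (top≤bot s)) (s≤s (m≤m+n _ _))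

  colBase≤entryAt : (rv : RowView ρ) (cv : ColView γ) → colBase cv ≤ entryAt rv cv
  colBase≤entryAt (row b i _) (col s x _) rewrite toℕ-combine x i = colBase≤value b s (toℕ<n x)

  module _ (a≤g : a ≤ g) (g≤h : g ≤ h) where

    value<colBase+span : ∀ b s {X I} → X < cols s → I < width b →
                         blockStart (order b s) + suc (width b * X + I)
                           < blockStart (order top s) + suc (a * X) + span
    value<colBase+span top s {X} {I} _ I<a = begin-strict
      blockStart (order top s) + suc (a * X + I)     ≡⟨ +-assoc _ (suc (a * X)) I ⟨
      blockStart (order top s) + suc (a * X) + I     <⟨ +-monoʳ-< _ I<span ⟩
      blockStart (order top s) + suc (a * X) + span  ∎
      where
      open ≤-Reasoning
      I<span : I < span
      I<span = ≤-trans I<a (≤-trans a≤g (≤-trans (m≤n+m g h) (m≤m+n (h + g) _)))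
    value<colBase+span mid left {X} X<h (s≤s z≤n) = begin-strict
      h * a + suc (1 * X + 0)  ≡⟨ solve (a ∷ h ∷ X ∷ []) ⟩
      suc X + a * h            ≤⟨ +-mono-≤ (≤-trans X<h (m≤m+n h g)) (*-monoʳ-≤ a (m≤m+n h g)) ⟩
      span                     <⟨ m<n+m span {suc (a * X)} z<s ⟩
      suc (a * X) + span       ∎
      where open ≤-Reasoning
    value<colBase+span mid right {X} X<g (s≤s z≤n) = begin-strict
      h * a + h * 1 + g * a + h * a + suc (1 * X + 0)
        ≡⟨ solve (a ∷ h ∷ g ∷ X ∷ []) ⟩
      h * a + h * 1 + (suc X + a * (h + g))
        ≤⟨ +-monoʳ-≤ (h * a + h * 1) (+-monoˡ-≤ (a * (h + g)) (≤-trans X<g (m≤n+m g h))) ⟩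
      h * a + h * 1 + span
        <⟨ +-monoʳ-< (h * a + h * 1) (m<n+m span {suc (a * X)} z<s) ⟩
      h * a + h * 1 + (suc (a * X) + span)
        ≡⟨ +-assoc (h * a + h * 1) (suc (a * X)) span ⟨
      h * a + h * 1 + suc (a * X) + span
        ∎
      where open ≤-Reasoning
    value<colBase+span bot left {X} {I} _ I<a = begin-strict
      h * a + h * 1 + g * a + suc (a * X + I)
        ≡⟨ solve (a ∷ h ∷ g ∷ X ∷ I ∷ []) ⟩
      suc (a * X) + (h + I + a * (h + g))
        <⟨ +-monoʳ-< (suc (a * X)) (+-monoˡ-< (a * (h + g)) (+-monoʳ-< h (≤-trans I<a a≤g))) ⟩
      suc (a * X) + span
        ∎
      where open ≤-Reasoning
    value<colBase+span bot right {X} {I} _ I<a = begin-strict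
      h * a + h * 1 + g * a + h * a + g * 1 + suc (a * X + I)
        ≡⟨ solve (a ∷ h ∷ g ∷ X ∷ I ∷ []) ⟩
      h * a + h * 1 + (suc (a * X) + (I + g + a * (h + g)))
        <⟨ +-monoʳ-< (h * a + h * 1) (+-monoʳ-< (suc (a * X)) (+-monoˡ-< (a * (h + g))
             (+-monoˡ-< g (≤-trans I<a (≤-trans a≤g g≤h))))) ⟩
      h * a + h * 1 + (suc (a * X) + span)
        ≡⟨ +-assoc (h * a + h * 1) (suc (a * X)) span ⟨
      h * a + h * 1 + suc (a * X) + span
        ∎
      where open ≤-Reasoning

    entryAt<colBase+span : (rv : RowView ρ) (cv : ColView γ) → entryAt rv cv < colBase cv + span
    entryAt<colBase+span (row b i _) (col s x _) rewrite toℕ-combine x i =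
      value<colBase+span b s (toℕ<n x) (toℕ<n i)

≤ᵇ-true : ∀ {m n} → m ≤ n → (m ≤ᵇ n) ≡ true
≤ᵇ-true = dec-true (_ ≤? _)

≤ᵇ-false : ∀ {m n} → ¬ m ≤ n → (m ≤ᵇ n) ≡ false
≤ᵇ-false = dec-false (_ ≤? _)

≡ᵇ-true : ∀ {m n} → m ≡ n → (m ≡ᵇ n) ≡ true
≡ᵇ-true = dec-true (_ ≟ _)

≡ᵇ-false : ∀ {m n} → m ≢ n → (m ≡ᵇ n) ≡ false
≡ᵇ-false = dec-false (_ ≟ _)

n/2≡⌊n/2⌋ : ∀ n → n / 2 ≡ ⌊ n /2⌋
n/2≡⌊n/2⌋ zero = refl
n/2≡⌊n/2⌋ (suc zero) = refl
n/2≡⌊n/2⌋ (suc (suc n)) =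
  trans (m/n≡1+[m∸n]/n {suc (suc n)} {2} (s≤s (s≤s z≤n))) (cong suc (n/2≡⌊n/2⌋ n))

module PaperArrangement (n₁ n₂ : ℕ) (n₁-odd : n₁ % 2 ≡ 1) (n₁≤n₂ : n₁ ≤ n₂) where

  a h g : ℕ
  a = n₁ / 2
  h = (n₂ + 1) / 2
  g = ⌊ n₂ /2⌋

  open SixBlocks a h g public

  n₁≡ : n₁ ≡ suc (a + a)
  n₁≡ = trans (m≡m%n+[m/n]*n n₁ 2)
              (cong₂ _+_ n₁-odd (trans (*-comm a 2) (cong (a +_) (+-identityʳ a))))

  h≡⌈n₂/2⌉ : h ≡ ⌈ n₂ /2⌉
  h≡⌈n₂/2⌉ = trans (n/2≡⌊n/2⌋ (n₂ + 1)) (cong ⌊_/2⌋ (+-comm n₂ 1))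

  n₂≡h+g : n₂ ≡ h + g
  n₂≡h+g = trans (sym (⌊n/2⌋+⌈n/2⌉≡n n₂)) (trans (+-comm g _) (cong (_+ g) (sym h≡⌈n₂/2⌉)))

  a≤g : a ≤ g
  a≤g = subst (_≤ g) (sym (n/2≡⌊n/2⌋ n₁)) (⌊n/2⌋-mono n₁≤n₂)

  g≤h : g ≤ h
  g≤h = subst (g ≤_) (sym h≡⌈n₂/2⌉) (⌊n/2⌋≤⌈n/2⌉ n₂)

  rowOf : (r : Fin n₁) → RowView (toℕ r)
  rowOf r = rowView (subst (toℕ r <_) n₁≡ (toℕ<n r))

  colOf : (c : Fin n₂) → ColView (toℕ c)
  colOf c = colView (subst (toℕ c <_) n₂≡h+g (toℕ<n c))

  private
    right≰h : ∀ {k} (x : Fin k) → ¬ suc (h + toℕ x) ≤ h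
    right≰h x = m+n≮m h (toℕ x)

    mid≰a : ¬ suc (a + 0) ≤ a
    mid≰a = m+n≮m a 0

    mid≡a+1 : suc (a + 0) ≡ a + 1
    mid≡a+1 = trans (cong suc (+-identityʳ a)) (+-comm 1 a)

    bot≰a : ∀ {k} (i : Fin k) → ¬ suc (suc (a + toℕ i)) ≤ a
    bot≰a i le = m+n≮m a (toℕ i) (≤-trans (n≤1+n _) le)

    bot≢a+1 : ∀ {k} (i : Fin k) → suc (suc (a + toℕ i)) ≢ a + 1
    bot≢a+1 i = >⇒≢ (s≤s (subst (_≤ suc (a + toℕ i)) (+-comm 1 a) (s≤s (m≤m+n a (toℕ i)))))

    bot∸[a+1] : ∀ {k} (i : Fin k) → suc (suc (a + toℕ i)) ∸ (a + 1) ≡ suc (toℕ i)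
    bot∸[a+1] i = trans (cong (suc (suc (a + toℕ i)) ∸_) (+-comm a 1))
                    (trans (cong (_∸ a) (sym (+-suc a (toℕ i)))) (m+n∸m≡n a (suc (toℕ i))))

  entry-value : ∀ {ρ γ} (rv : RowView ρ) (cv : ColView γ) →
                entry n₁ n₂ (suc ρ) (suc γ) ≡ entryAt rv cv
  entry-value (row top i refl) (col left x refl)
    rewrite ≤ᵇ-true (toℕ<n i) | ≤ᵇ-true (toℕ<n x)
    = sym (value-topLeft x i)
  entry-value (row top i refl) (col right x refl)
    rewrite ≤ᵇ-true (toℕ<n i) | ≤ᵇ-false (right≰h x)
    = sym (value-topRight x i)
  entry-value (row mid zero refl) (col left x refl)
    rewrite ≤ᵇ-false mid≰a | ≡ᵇ-true mid≡a+1 | ≤ᵇ-true (toℕ<n x)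
    = sym (value-midLeft x)
  entry-value (row mid zero refl) (col right x refl)
    rewrite ≤ᵇ-false mid≰a | ≡ᵇ-true mid≡a+1 | ≤ᵇ-false (right≰h x)
    = sym (value-midRight n₂≡h+g x)
  entry-value (row bot i refl) (col left x refl)
    rewrite ≤ᵇ-false (bot≰a i) | ≡ᵇ-false (bot≢a+1 i) | ≤ᵇ-true (toℕ<n x) | bot∸[a+1] i
    = sym (value-botLeft n₂≡h+g x i)
  entry-value (row bot i refl) (col right x refl)
    rewrite ≤ᵇ-false (bot≰a i) | ≡ᵇ-false (bot≢a+1 i) | ≤ᵇ-false (right≰h x) | bot∸[a+1] i
          | +-∸-assoc n₂ {suc (h + toℕ x)} {1} (s≤s z≤n)
    = sym (value-botRight n₂≡h+g x i)

  arrA≡entryAt : ∀ r c → arrA n₁ n₂ r c ≡ entryAt (rowOf r) (colOf c)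
  arrA≡entryAt r c = entry-value (rowOf r) (colOf c)

  isArrangement : IsArrangement (arrA n₁ n₂)
  isArrangement = injective⇒isArrangement (arrA n₁ n₂) bounds injective
    where
    bounds : ∀ r c → 1 ≤ arrA n₁ n₂ r c × arrA n₁ n₂ r c ≤ n₁ * n₂
    bounds r c = subst₂ (λ v N → 1 ≤ v × v ≤ N) (sym (arrA≡entryAt r c))
                   (sym (cong₂ _*_ n₁≡ n₂≡h+g)) (entryAt-bounds (rowOf r) (colOf c))
    injective : ∀ r c r′ c′ → arrA n₁ n₂ r c ≡ arrA n₁ n₂ r′ c′ → r ≡ r′ × c ≡ c′
    injective r c r′ c′ eq = map toℕ-injective toℕ-injective
      (entryAt-injective (rowOf r) (colOf c) (rowOf r′) (colOf c′)
        (trans (sym (arrA≡entryAt r c)) (trans eq (arrA≡entryAt r′ c′))))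

  spread≤span∸1 : spread (arrA n₁ n₂) ≤ span ∸ 1
  spread≤span∸1 = spread-bounded (arrA n₁ n₂) row-bound col-bound
    where
    row-bound : ∀ r → lineDiff (arrA n₁ n₂ r) ≤ span ∸ 1
    row-bound r = lineDiff-bounded (arrA n₁ n₂ r)
      (λ c → subst (rowBase (rowOf r) ≤_) (sym (arrA≡entryAt r c))
               (rowBase≤entryAt (rowOf r) (colOf c)))
      (λ c → subst (_< rowBase (rowOf r) + span) (sym (arrA≡entryAt r c))
               (entryAt<rowBase+span (rowOf r) (colOf c)))
    col-bound : ∀ c → lineDiff (λ r → arrA n₁ n₂ r c) ≤ span ∸ 1
    col-bound c = lineDiff-bounded (λ r → arrA n₁ n₂ r c)
      (λ r → subst (colBase (colOf c) ≤_) (sym (arrA≡entryAt r c))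
               (colBase≤entryAt (rowOf r) (colOf c)))
      (λ r → subst (_< colBase (colOf c) + span) (sym (arrA≡entryAt r c))
               (entryAt<colBase+span a≤g g≤h (rowOf r) (colOf c)))

  span∸1≤spread : (B : Matrix n₁ n₂) → IsArrangement B → span ∸ 1 ≤ spread B
  span∸1≤spread B B-arr = ∸-monoˡ-≤ 1 (+-cancelʳ-≤ (a * n₂) span (suc (spread B)) (begin
    span + a * n₂                  ≡⟨ cong (λ n → span + a * n) n₂≡h+g ⟩
    suc a * (h + g) + a * (h + g)  ≡⟨ split a (h + g) ⟩
    suc (a + a) * (h + g)          ≡⟨ cong₂ _*_ n₁≡ n₂≡h+g ⟨
    n₁ * n₂                        ≤⟨ spread-lowerBound B B-arr a a<n₁ (≤-reflexive n₁≡) 0<n₂ ⟩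
    suc (spread B) + a * n₂        ∎))
    where
    open ≤-Reasoning
    a<n₁ : a < n₁
    a<n₁ = subst (a <_) (sym n₁≡) (s≤s (m≤m+n a a))
    0<n₂ : 0 < n₂
    0<n₂ = ≤-trans (subst (0 <_) (sym n₁≡) z<s) n₁≤n₂
    split : ∀ x y → suc x * y + x * y ≡ suc (x + x) * y
    split x y = solve (x ∷ y ∷ [])

  targetSpread≡span∸1 : targetSpread n₁ n₂ ≡ span ∸ 1
  targetSpread≡span∸1 = cong (_∸ 1) (begin
    (n₁ + 1) * n₂ / 2                ≡⟨ cong₂ (λ m n → (m + 1) * n / 2) n₁≡ n₂≡h+g ⟩
    (suc (a + a) + 1) * (h + g) / 2  ≡⟨ cong (_/ 2) (double a (h + g)) ⟩
    span * 2 / 2                     ≡⟨ m*n/n≡m span 2 ⟩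
    span                             ∎)
    where
    open ≡-Reasoning
    double : ∀ x y → (suc (x + x) + 1) * y ≡ suc x * y * 2
    double x y = solve (x ∷ y ∷ [])

mainTheorem4 : (n₁ n₂ : ℕ) → 1 ≤ n₁ → n₁ ≤ n₂ → n₁ % 2 ≡ 1 →
    IsArrangement (arrA n₁ n₂)
    × spread (arrA n₁ n₂) ≡ targetSpread n₁ n₂
    × ((B : Matrix n₁ n₂) → IsArrangement B → spread (arrA n₁ n₂) ≤ spread B)
mainTheorem4 n₁ n₂ _ n₁≤n₂ n₁-odd = isArrangement , spread≡target , optimal
  where
  open PaperArrangement n₁ n₂ n₁-odd n₁≤n₂
  optimal : (B : Matrix n₁ n₂) → IsArrangement B → spread (arrA n₁ n₂) ≤ spread B
  optimal B B-arr = ≤-trans spread≤span∸1 (span∸1≤spread B B-arr)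
  spread≡target : spread (arrA n₁ n₂) ≡ targetSpread n₁ n₂
  spread≡target =
    trans (≤-antisym spread≤span∸1 (span∸1≤spread _ isArrangement)) (sym targetSpread≡span∸1)
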